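{- Let $k\ge 0$ be an integer and $T$ a string. Every generalised run $(T[x\mathinner{.\,.} y),\ell)$ in $T$ induces at most $2k+1$ (maximal) uniform $k$-runs of period $\ell$.
   Context: $T[i\mathinner{.\,.} j)=T[i]\cdots T[j-1]$, positions numbered from 1. A uniform $k$-run of period $\ell$ is a substring $T[a\mathinner{.\,.} b)$ with $b-a\ge 2\ell$ such that the sets $\{j\in[i\mathinner{.\,.} i+\ell): T[j]\ne T[j+\ell]\}$ for all $i\in[a\mathinner{.\,.} b-2\ell]$ have cardinality at most $k$ and are all equal; it is maximal if it cannot be extended to the left or right by a position while remaining a uniform $k$-run of period $\ell$. A generalised run is a pair $(T[x\mathinner{.\,.} y),p)$ with $2p\le y-x$ such that $T[x\mathinner{.\,.} y)$ has period $p$, (1) $x=1$ or $T[x-1\mathinner{.\,.} y)$ does not have period $p$, and (2) $y=|T|+1$ or $T[x\mathinner{.\,.} y]$ does not have period $p$. A generalised run $(T[x\mathinner{.\,.} y),\ell)$ induces a uniform $k$-run $T[a\mathinner{.\,.} b)$ of period $\ell$ if $[x\mathinner{.\,.} y-\ell)\cap[a\mathinner{.\,.} b-\ell)\ne\emptyset$. -}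

module Defs where

open import Data.Nat using (ℕ; _+_; _*_; _∸_; _≤_; _<_)
open import Data.Product using (Σ; ∃; _×_; _,_)
open import Data.Sum using (_⊎_)
open import Data.List using (List; length)
open import Data.List.Membership.Propositional using (_∈_)
open import Data.List.Relation.Unary.Unique.Propositional using (Unique)
open import Relation.Binary.PropositionalEquality using (_≡_; _≢_)
open import Relation.Nullary using (¬_)
open import Function.Bundles using (_⇔_)

-- A string of length n over alphabet A is given by its length n and a
-- function T : ℕ → A; only the positions 1 … n (1-based) are meaningful,
-- and every definition below only inspects positions in [1 .. n].

ValidSub : (n a b : ℕ) → Set
ValidSub n a b = 1 ≤ a × a ≤ b × b ≤ n + 1

HasPeriod : {A : Set} → (ℕ → A) → (x y p : ℕ) → Set
HasPeriod T x y p = 1 ≤ p × (∀ i → x ≤ i → i + p < y → T i ≡ T (i + p))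

InMismatch : {A : Set} → (ℕ → A) → (ℓ i j : ℕ) → Set
InMismatch T ℓ i j = i ≤ j × j < i + ℓ × T j ≢ T (j + ℓ)

-- uniform k-run T[a .. b) of period ℓ: b - a ≥ 2ℓ, and there is one set S
-- (given as a duplicate-free list, so |S| = length) with |S| ≤ k that equals
-- the mismatch set for every i ∈ [a .. b - 2ℓ].
UniformRun : {A : Set} → (n : ℕ) → (ℕ → A) → (k ℓ a b : ℕ) → Set
UniformRun n T k ℓ a b =
  ValidSub n a b × 1 ≤ ℓ × a + 2 * ℓ ≤ b ×
  Σ (List ℕ) (λ S → Unique S × length S ≤ k ×
    (∀ i → a ≤ i → i + 2 * ℓ ≤ b → ∀ j → (j ∈ S) ⇔ InMismatch T ℓ i j))

MaximalUniformRun : {A : Set} → (n : ℕ) → (ℕ → A) → (k ℓ a b : ℕ) → Set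
MaximalUniformRun n T k ℓ a b =
  UniformRun n T k ℓ a b ×
  (2 ≤ a → ¬ UniformRun n T k ℓ (a ∸ 1) b) ×
  (b ≤ n → ¬ UniformRun n T k ℓ a (b + 1))

GenRun : {A : Set} → (n : ℕ) → (ℕ → A) → (x y p : ℕ) → Set
GenRun n T x y p =
  ValidSub n x y × x + 2 * p ≤ y × HasPeriod T x y p ×
  (x ≡ 1 ⊎ ¬ HasPeriod T (x ∸ 1) y p) ×
  (y ≡ n + 1 ⊎ ¬ HasPeriod T x (y + 1) p)

-- (T[x .. y), ℓ) induces T[a .. b):  [x .. y-ℓ) ∩ [a .. b-ℓ) ≠ ∅
Induces : (x y ℓ a b : ℕ) → Set
Induces x y ℓ a b = ∃ λ i → x ≤ i × i + ℓ < y × a ≤ i × i + ℓ < b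

{-# OPTIONS --safe #-}
-- A uniform run T[a .. b) with mismatch set S is an interval whose mismatches j (T[j] ≠ T[j + ℓ]
-- with j, j + ℓ ∈ [a .. b)) are exactly S and all lie in [b − 2ℓ .. a + ℓ).  Two such intervals
-- with the same S whose ranges [a .. b − ℓ) meet merge into one, so two maximal runs with the
-- same S and a common position coincide.  For a run induced by the periodic T[x .. y) no mismatch
-- lies in [x .. y − ℓ), and as S fits into a window of length ℓ, either S = ∅, or S lies left of x,
-- or S lies right of y − ℓ.  An empty run contains T[x .. y), hence is unique; of two left runs
-- the one starting later has the smaller mismatch set, so left runs with |S| equal coincide, and
-- likewise on the right.  Thus the code 0, |S| or k + |S| ∈ [0 .. 2k] determines the run.
module Submission where

open import Defs
open import Data.Nat using (ℕ; suc; pred; _+_; _*_; _∸_; _≤_; _<_; _⊓_; _⊔_; s≤s; _≤?_; _<?_)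
open import Data.Nat.Properties
open import Data.List using (List; []; _∷_; length; upTo)
open import Data.List.Properties using (length-upTo)
open import Data.List.Relation.Unary.All as All using (All; []; _∷_)
open import Data.List.Relation.Unary.AllPairs using ([]; _∷_)
open import Data.List.Relation.Unary.Any using (here; there)
open import Data.List.Relation.Unary.Unique.Propositional using (Unique)
open import Data.List.Relation.Unary.Unique.Propositional.Properties using (upTo⁺)
open import Data.List.Membership.Propositional using (_∈_)
open import Data.List.Membership.Propositional.Properties using (∈-upTo⁺; ∈-length)
open import Data.List.Relation.Binary.Subset.Propositional using (_⊆_)
open import Data.List.Membership.DecPropositional using (_∈?_)
open import Data.List.Fresh as List# using (fromList)
import Data.List.Fresh.Relation.Unary.Any as Any#
import Data.List.Fresh.Membership.Setoid as Membership#
import Data.List.Fresh.Membership.Setoid.Properties as Membership#ₚ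
open import Relation.Binary.Definitions using (DecidableEquality)
open import Relation.Binary.PropositionalEquality using (_≡_; _≢_; refl; sym; trans; cong; cong₂; subst; subst₂; setoid)
open import Relation.Nullary using (¬_; yes; no; contradiction)
open import Data.Product using (_×_; _,_; proj₁; proj₂)
open import Data.Sum using (_⊎_; inj₁; inj₂; [_,_]′)
open import Data.Empty using (⊥-elim)
open import Function using (id; _∘_)
open import Function.Bundles using (_⇔_; mk⇔; Equivalence)

module _ {A : Set} where
  open Membership# (setoid A) renaming (_∈_ to _∈#_)

  private
    length-fromList : ∀ {xs : List A} (u : Unique xs) → List#.length (fromList u) ≡ length xs
    length-fromList [] = refl
    length-fromList (_ ∷ u) = cong suc (length-fromList u)

    ∈-fromList⁺ : ∀ {x} {xs : List A} (u : Unique xs) → x ∈ xs → x ∈# fromList u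
    ∈-fromList⁺ (_ ∷ _) (here x≡y) = Any#.here x≡y
    ∈-fromList⁺ (_ ∷ u) (there x∈xs) = Any#.there (∈-fromList⁺ u x∈xs)

    ∈-fromList⁻ : ∀ {x} {xs : List A} (u : Unique xs) → x ∈# fromList u → x ∈ xs
    ∈-fromList⁻ (_ ∷ _) (Any#.here x≡y) = here x≡y
    ∈-fromList⁻ (_ ∷ u) (Any#.there x∈xs) = there (∈-fromList⁻ u x∈xs)

  Unique-⊆⇒length-≤ : ∀ {xs ys : List A} → Unique xs → Unique ys → xs ⊆ ys → length xs ≤ length ys
  Unique-⊆⇒length-≤ {xs} {ys} uxs uys xs⊆ys = begin
    length xs                    ≡⟨ sym (length-fromList uxs) ⟩
    List#.length (fromList uxs)  ≤⟨ Membership#ₚ.injection (setoid A) id (∈-fromList⁺ uys ∘ xs⊆ys ∘ ∈-fromList⁻ uxs) ⟩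
    List#.length (fromList uys)  ≡⟨ length-fromList uys ⟩
    length ys                    ∎
    where open ≤-Reasoning

  Unique-⊆-length-≥⇒⊇ : DecidableEquality A → ∀ {xs ys : List A} → Unique xs → Unique ys →
                        xs ⊆ ys → length ys ≤ length xs → ys ⊆ xs
  Unique-⊆-length-≥⇒⊇ _≟_ {xs} {ys} uxs uys xs⊆ys ys≤xs {z} z∈ys with _∈?_ _≟_ z xs
  ... | yes z∈xs = z∈xs
  ... | no z∉xs = contradiction (≤-trans xs<ys ys≤xs) (<-irrefl refl)
    where
    open ≤-Reasoning
    xs<ys : length xs < length ys
    xs<ys = begin-strict
      length xs                    ≡⟨ sym (length-fromList uxs) ⟩
      List#.length (fromList uxs)  <⟨ Membership#ₚ.strict-injection (setoid A) id (∈-fromList⁺ uys ∘ xs⊆ys ∘ ∈-fromList⁻ uxs)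
                                        (z , ∈-fromList⁺ uys z∈ys , z∉xs ∘ ∈-fromList⁻ uxs) ⟩
      List#.length (fromList uys)  ≡⟨ length-fromList uys ⟩
      length ys                    ∎

module _ {X : Set} {P : X → Set} (code : ∀ {r} → P r → ℕ) {m : ℕ}
         (code< : ∀ {r} (p : P r) → code p < m)
         (code-injective : ∀ {r s} (p : P r) (q : P s) → code p ≡ code q → r ≡ s) where

  private
    codes : ∀ {rs} → All P rs → List ℕ
    codes = All.reduce code

    length-codes : ∀ {rs} (ps : All P rs) → length (codes ps) ≡ length rs
    length-codes [] = refl
    length-codes (_ ∷ ps) = cong suc (length-codes ps)

    codes-fresh : ∀ {r rs} (p : P r) → All (λ s → ¬ r ≡ s) rs → (ps : All P rs) → All (λ c → ¬ code p ≡ c) (codes ps)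
    codes-fresh p [] [] = []
    codes-fresh p (r≢s ∷ r≢rs) (q ∷ ps) = r≢s ∘ code-injective p q ∷ codes-fresh p r≢rs ps

    codes-unique : ∀ {rs} → Unique rs → (ps : All P rs) → Unique (codes ps)
    codes-unique [] [] = []
    codes-unique (r≢rs ∷ u) (p ∷ ps) = codes-fresh p r≢rs ps ∷ codes-unique u ps

    codes-bounded : ∀ {rs} (ps : All P rs) → codes ps ⊆ upTo m
    codes-bounded (p ∷ _) (here refl) = ∈-upTo⁺ (code< p)
    codes-bounded (_ ∷ ps) (there c∈) = codes-bounded ps c∈

  length-≤-injective-code : ∀ {rs} → Unique rs → All P rs → length rs ≤ m
  length-≤-injective-code {rs} u ps = begin
    length rs          ≡⟨ sym (length-codes ps) ⟩
    length (codes ps)  ≤⟨ Unique-⊆⇒length-≤ (codes-unique u ps) (upTo⁺ m) (codes-bounded ps) ⟩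
    length (upTo m)    ≡⟨ length-upTo m ⟩
    m                  ∎
    where open ≤-Reasoning

private
  m+2*n≡m+n+n : ∀ m n → m + 2 * n ≡ m + n + n
  m+2*n≡m+n+n m n = trans (cong (λ t → m + (n + t)) (+-identityʳ n)) (sym (+-assoc m n n))

  m<n+o⇒m+o<n+2*o : ∀ {m n o} → m < n + o → m + o < n + 2 * o
  m<n+o⇒m+o<n+2*o {m} {n} {o} m<n+o = subst (m + o <_) (sym (m+2*n≡m+n+n n o)) (+-monoˡ-< o m<n+o)

  m+o<n+2*o⇒m<n+o : ∀ {m n o} → m + o < n + 2 * o → m < n + o
  m+o<n+2*o⇒m<n+o {m} {n} {o} lt = +-cancelʳ-< o m (n + o) (subst (m + o <_) (m+2*n≡m+n+n n o) lt)

  m≤n⇒m<n+1 : ∀ {m n} → m ≤ n → m < n + 1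
  m≤n⇒m<n+1 {m} {n} m≤n = subst (m <_) (+-comm 1 n) (s≤s m≤n)

  m<n+1⇒m≤n : ∀ {m n} → m < n + 1 → m ≤ n
  m<n+1⇒m≤n {m} {n} m<n+1 = m<1+n⇒m≤n (subst (m <_) (+-comm n 1) m<n+1)

  m⊓n≤o⇒m≤o⊎n≤o : ∀ {m n o} → m ⊓ n ≤ o → m ≤ o ⊎ n ≤ o
  m⊓n≤o⇒m≤o⊎n≤o {m} {n} {o} le = [ (λ e → inj₁ (subst (_≤ o) e le)) , (λ e → inj₂ (subst (_≤ o) e le)) ]′ (⊓-sel m n)

  o<m⊔n⇒o<m⊎o<n : ∀ {m n o} → o < m ⊔ n → o < m ⊎ o < n
  o<m⊔n⇒o<m⊎o<n {m} {n} {o} lt = [ (λ e → inj₁ (subst (o <_) e lt)) , (λ e → inj₂ (subst (o <_) e lt)) ]′ (⊔-sel m n)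

module UniformRuns {A : Set} (n : ℕ) (T : ℕ → A) (k ℓ : ℕ) where

  Mismatch : ℕ → Set
  Mismatch j = T j ≢ T (j + ℓ)

  MismatchIn : (a b j : ℕ) → Set
  MismatchIn a b j = a ≤ j × j + ℓ < b × Mismatch j

  -- The window condition of UniformRun, read off its first and last window: S is the set of all
  -- mismatches inside [a .. b), and all of them lie in [b − 2ℓ .. a + ℓ).
  record Uniform (a b : ℕ) (S : List ℕ) : Set where
    field
      sound : ∀ {j} → j ∈ S → MismatchIn a b j
      complete : ∀ {j} → MismatchIn a b j → j ∈ S
      in-every-window : ∀ {j} → j ∈ S → j < a + ℓ × b ≤ j + 2 * ℓ

  open Uniform

  windows⇒Uniform : ∀ {a b S} → 1 ≤ ℓ → a + 2 * ℓ ≤ b →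
                   (∀ i → a ≤ i → i + 2 * ℓ ≤ b → ∀ j → (j ∈ S) ⇔ InMismatch T ℓ i j) →
                   Uniform a b S
  windows⇒Uniform {a} {b} {S} 1≤ℓ a+2ℓ≤b window = record
    { sound = λ j∈S → let a≤j , j<a+ℓ , mj = first j∈S in a≤j , <-≤-trans (m<n+o⇒m+o<n+2*o j<a+ℓ) a+2ℓ≤b , mj
    ; complete = complete′
    ; in-every-window = λ {j} j∈S → proj₁ (proj₂ (first j∈S)) ,
                                     subst (_≤ j + 2 * ℓ) e+2ℓ≡b (+-monoˡ-≤ (2 * ℓ) (proj₁ (last j∈S)))
    }
    where
    e : ℕ
    e = b ∸ 2 * ℓ
    a≤e : a ≤ e
    a≤e = m+n≤o⇒m≤o∸n a a+2ℓ≤b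
    e+2ℓ≡b : e + 2 * ℓ ≡ b
    e+2ℓ≡b = m∸n+n≡m (m+n≤o⇒n≤o a a+2ℓ≤b)
    first : ∀ {j} → j ∈ S → InMismatch T ℓ a j
    first = Equivalence.to (window a ≤-refl a+2ℓ≤b _)
    last : ∀ {j} → j ∈ S → InMismatch T ℓ e j
    last = Equivalence.to (window e a≤e (≤-reflexive e+2ℓ≡b) _)
    complete′ : ∀ {j} → MismatchIn a b j → j ∈ S
    complete′ {j} (a≤j , j+ℓ<b , mj) with j ≤? e
    ... | yes j≤e = Equivalence.from (window j a≤j (subst (j + 2 * ℓ ≤_) e+2ℓ≡b (+-monoˡ-≤ (2 * ℓ) j≤e)) j)
                      (≤-refl , m<m+n j 1≤ℓ , mj)
    ... | no j≰e = Equivalence.from (window e a≤e (≤-reflexive e+2ℓ≡b) j)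
                     (<⇒≤ (≰⇒> j≰e) , m+o<n+2*o⇒m<n+o (subst (j + ℓ <_) (sym e+2ℓ≡b) j+ℓ<b) , mj)

  Uniform⇒uniformRun : ∀ {a b S} → ValidSub n a b → 1 ≤ ℓ → a + 2 * ℓ ≤ b → Unique S → length S ≤ k →
                       Uniform a b S → UniformRun n T k ℓ a b
  Uniform⇒uniformRun {a} {b} {S} valid 1≤ℓ a+2ℓ≤b S-unique |S|≤k U =
    valid , 1≤ℓ , a+2ℓ≤b , S , S-unique , |S|≤k , λ i a≤i i+2ℓ≤b j → mk⇔ (to i a≤i i+2ℓ≤b) (from i a≤i i+2ℓ≤b)
    where
    to : ∀ i → a ≤ i → i + 2 * ℓ ≤ b → ∀ {j} → j ∈ S → InMismatch T ℓ i j
    to i a≤i i+2ℓ≤b {j} j∈S =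
      let j<a+ℓ , b≤j+2ℓ = in-every-window U j∈S in
      +-cancelʳ-≤ (2 * ℓ) i j (≤-trans i+2ℓ≤b b≤j+2ℓ) , <-≤-trans j<a+ℓ (+-monoˡ-≤ ℓ a≤i) , proj₂ (proj₂ (sound U j∈S))
    from : ∀ i → a ≤ i → i + 2 * ℓ ≤ b → ∀ {j} → InMismatch T ℓ i j → j ∈ S
    from i a≤i i+2ℓ≤b (i≤j , j<i+ℓ , mj) = complete U (≤-trans a≤i i≤j , <-≤-trans (m<n+o⇒m+o<n+2*o j<i+ℓ) i+2ℓ≤b , mj)

  Uniform-restrict : ∀ {a b c d S} → Uniform a b S → a ≤ c → d ≤ b →
                     (∀ {j} → j ∈ S → c ≤ j × j + ℓ < d) → Uniform c d S
  Uniform-restrict U a≤c d≤b inside = record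
    { sound = λ j∈S → let c≤j , j+ℓ<d = inside j∈S in c≤j , j+ℓ<d , proj₂ (proj₂ (sound U j∈S))
    ; complete = λ (c≤j , j+ℓ<d , mj) → complete U (≤-trans a≤c c≤j , <-≤-trans j+ℓ<d d≤b , mj)
    ; in-every-window = λ j∈S → let j<a+ℓ , b≤j+2ℓ = in-every-window U j∈S in
                                <-≤-trans j<a+ℓ (+-monoˡ-≤ ℓ a≤c) , ≤-trans d≤b b≤j+2ℓ
    }

  Uniform-extendˡ : ∀ {a b c d S} → Uniform c d S → c < a → b ≤ d → Uniform a b S → Uniform (pred a) b S
  Uniform-extendˡ V c<a b≤d U = Uniform-restrict V (suc[m]≤n⇒m≤pred[n] c<a) b≤d
    (λ j∈S → let a≤j , j+ℓ<b , _ = sound U j∈S in ≤-trans pred[n]≤n a≤j , j+ℓ<b)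

  Uniform-extendʳ : ∀ {a b c d S} → Uniform c d S → c ≤ a → b < d → Uniform a b S → Uniform a (b + 1) S
  Uniform-extendʳ {b = b} {d = d} V c≤a b<d U = Uniform-restrict V c≤a (subst (_≤ d) (+-comm 1 b) b<d)
    (λ j∈S → let a≤j , j+ℓ<b , _ = sound U j∈S in a≤j , <-≤-trans j+ℓ<b (m≤m+n b 1))

  -- The mismatch ranges [a .. b − ℓ) and [a′ .. b′ − ℓ) meet at o, so they cover that of the hull.
  Uniform-hull : ∀ {a b a′ b′ S} → Induces a b ℓ a′ b′ → Uniform a b S → Uniform a′ b′ S →
                 Uniform (a ⊓ a′) (b ⊔ b′) S
  Uniform-hull {a} {b} {a′} {b′} {S} (o , a≤o , o+ℓ<b , a′≤o , o+ℓ<b′) U U′ = record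
    { sound = λ j∈S → let a≤j , j+ℓ<b , mj = sound U j∈S in
                      ≤-trans (m⊓n≤m a a′) a≤j , <-≤-trans j+ℓ<b (m≤m⊔n b b′) , mj
    ; complete = complete′
    ; in-every-window = λ {j} j∈S →
        let j<a+ℓ , b≤j+2ℓ = in-every-window U j∈S
            j<a′+ℓ , b′≤j+2ℓ = in-every-window U′ j∈S
        in subst (j <_) (sym (+-distribʳ-⊓ ℓ a a′)) (⊓-pres-m< j<a+ℓ j<a′+ℓ) , ⊔-lub b≤j+2ℓ b′≤j+2ℓ
    }
    where
    complete′ : ∀ {j} → MismatchIn (a ⊓ a′) (b ⊔ b′) j → j ∈ S
    complete′ {j} (a⊓a′≤j , j+ℓ<b⊔b′ , mj) with j ≤? o
    ... | yes j≤o = [ (λ a≤j → complete U (a≤j , ≤-<-trans (+-monoˡ-≤ ℓ j≤o) o+ℓ<b , mj))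
                    , (λ a′≤j → complete U′ (a′≤j , ≤-<-trans (+-monoˡ-≤ ℓ j≤o) o+ℓ<b′ , mj))
                    ]′ (m⊓n≤o⇒m≤o⊎n≤o a⊓a′≤j)
    ... | no j≰o = [ (λ j+ℓ<b → complete U (≤-trans a≤o o≤j , j+ℓ<b , mj))
                   , (λ j+ℓ<b′ → complete U′ (≤-trans a′≤o o≤j , j+ℓ<b′ , mj))
                   ]′ (o<m⊔n⇒o<m⊎o<n j+ℓ<b⊔b′)
      where
      o≤j : o ≤ j
      o≤j = <⇒≤ (≰⇒> j≰o)

  Uniform-resp-⊆⊇ : ∀ {a b S S′} → S ⊆ S′ → S′ ⊆ S → Uniform a b S → Uniform a b S′
  Uniform-resp-⊆⊇ S⊆S′ S′⊆S U = record
    { sound = sound U ∘ S′⊆S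
    ; complete = S⊆S′ ∘ complete U
    ; in-every-window = in-every-window U ∘ S′⊆S
    }

  record MaximalRun (a b : ℕ) : Set where
    field
      1≤a : 1 ≤ a
      b≤n+1 : b ≤ n + 1
      S : List ℕ
      S-unique : Unique S
      |S|≤k : length S ≤ k
      uniform : Uniform a b S
      inclusion-maximal : ∀ {c d} → 1 ≤ c → d ≤ n + 1 → c ≤ a → b ≤ d → Uniform c d S → c ≡ a × d ≡ b

  open MaximalRun

  maximalRun : ∀ {a b} → MaximalUniformRun n T k ℓ a b → MaximalRun a b
  maximalRun {a} {b} (((1≤a , _ , b≤n+1) , 1≤ℓ , a+2ℓ≤b , S , S-unique , |S|≤k , window) , ¬extendˡ , ¬extendʳ) = record
    { 1≤a = 1≤a
    ; b≤n+1 = b≤n+1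
    ; S = S
    ; S-unique = S-unique
    ; |S|≤k = |S|≤k
    ; uniform = U
    ; inclusion-maximal = inclusion-maximal′
    }
    where
    U : Uniform a b S
    U = windows⇒Uniform 1≤ℓ a+2ℓ≤b window
    a≤b : a ≤ b
    a≤b = m+n≤o⇒m≤o a a+2ℓ≤b
    -- A proper uniform extension restricts to an extension by one position.
    inclusion-maximal′ : ∀ {c d} → 1 ≤ c → d ≤ n + 1 → c ≤ a → b ≤ d → Uniform c d S → c ≡ a × d ≡ b
    inclusion-maximal′ {c} {d} 1≤c d≤n+1 c≤a b≤d V = ≤∧≮⇒≡ c≤a c≮a , sym (≤∧≮⇒≡ b≤d b≮d)
      where
      c≮a : ¬ c < a
      c≮a c<a = ¬extendˡ (≤-trans (s≤s 1≤c) c<a) (subst (λ a₁ → UniformRun n T k ℓ a₁ b) (pred[m∸n]≡m∸[1+n] a 0)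
        (Uniform⇒uniformRun (≤-trans 1≤c (suc[m]≤n⇒m≤pred[n] c<a) , ≤-trans pred[n]≤n a≤b , b≤n+1) 1≤ℓ
          (≤-trans (+-monoˡ-≤ (2 * ℓ) (pred[n]≤n {a})) a+2ℓ≤b) S-unique |S|≤k (Uniform-extendˡ V c<a b≤d U)))
      b≮d : ¬ b < d
      b≮d b<d = ¬extendʳ b≤n (Uniform⇒uniformRun (1≤a , ≤-trans a≤b (m≤m+n b 1) , +-monoˡ-≤ 1 b≤n) 1≤ℓ
                  (≤-trans a+2ℓ≤b (m≤m+n b 1)) S-unique |S|≤k (Uniform-extendʳ V c≤a b<d U))
        where
        b≤n : b ≤ n
        b≤n = m<n+1⇒m≤n (<-≤-trans b<d d≤n+1)

  maximal-runs-equal : ∀ {a b a′ b′} (R : MaximalRun a b) (R′ : MaximalRun a′ b′) →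
                       S R ⊆ S R′ → S R′ ⊆ S R → Induces a b ℓ a′ b′ → (a , b) ≡ (a′ , b′)
  maximal-runs-equal {a} {b} {a′} {b′} R R′ S⊆S′ S′⊆S common =
    let a⊓a′≡a , b⊔b′≡b = inclusion-maximal R 1≤a⊓a′ b⊔b′≤n+1 (m⊓n≤m a a′) (m≤m⊔n b b′) hull
        a⊓a′≡a′ , b⊔b′≡b′ = inclusion-maximal R′ 1≤a⊓a′ b⊔b′≤n+1 (m⊓n≤n a a′) (m≤n⊔m b b′)
                               (Uniform-resp-⊆⊇ S⊆S′ S′⊆S hull)
    in cong₂ _,_ (trans (sym a⊓a′≡a) a⊓a′≡a′) (trans (sym b⊔b′≡b) b⊔b′≡b′)
    where
    hull : Uniform (a ⊓ a′) (b ⊔ b′) (S R)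
    hull = Uniform-hull common (uniform R) (Uniform-resp-⊆⊇ S′⊆S S⊆S′ (uniform R′))
    1≤a⊓a′ : 1 ≤ a ⊓ a′
    1≤a⊓a′ = ⊓-glb (1≤a R) (1≤a R′)
    b⊔b′≤n+1 : b ⊔ b′ ≤ n + 1
    b⊔b′≤n+1 = ⊔-lub (b≤n+1 R) (b≤n+1 R′)

  nested-runs-equal : ∀ {a b a′ b′ j} (R : MaximalRun a b) (R′ : MaximalRun a′ b′) →
                      S R′ ⊆ S R → length (S R) ≤ length (S R′) → j ∈ S R′ → (a , b) ≡ (a′ , b′)
  nested-runs-equal {j = j} R R′ S′⊆S |S|≤|S′| j∈S′ =
    let a≤j , j+ℓ<b , _ = sound (uniform R) (S′⊆S j∈S′)
        a′≤j , j+ℓ<b′ , _ = sound (uniform R′) j∈S′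
    in maximal-runs-equal R R′ (Unique-⊆-length-≥⇒⊇ _≟_ (S-unique R′) (S-unique R) S′⊆S |S|≤|S′|) S′⊆S
         (j , a≤j , j+ℓ<b , a′≤j , j+ℓ<b′)

  -- T[x .. y) only needs to be periodic.
  module InducedBy {x y : ℕ} (1≤x : 1 ≤ x) (y≤n+1 : y ≤ n + 1) (x+2ℓ≤y : x + 2 * ℓ ≤ y) (1≤ℓ : 1 ≤ ℓ)
                   (periodic : ∀ i → x ≤ i → i + ℓ < y → T i ≡ T (i + ℓ)) where

    no-mismatch-inside : ∀ {j} → x ≤ j → j + ℓ < y → ¬ Mismatch j
    no-mismatch-inside x≤j j+ℓ<y mj = mj (periodic _ x≤j j+ℓ<y)

    factor-uniform : Uniform x y []
    factor-uniform = record
      { sound = λ ()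
      ; complete = λ (x≤j , j+ℓ<y , mj) → contradiction mj (no-mismatch-inside x≤j j+ℓ<y)
      ; in-every-window = λ ()
      }

    outside-factor : ∀ {a b j} (R : MaximalRun a b) → j ∈ S R → j < x ⊎ y ≤ j + ℓ
    outside-factor {j = j} R j∈S with j <? x
    ... | yes j<x = inj₁ j<x
    ... | no j≮x = inj₂ (≮⇒≥ λ j+ℓ<y → no-mismatch-inside (≮⇒≥ j≮x) j+ℓ<y (proj₂ (proj₂ (sound (uniform R) j∈S))))

    one-sided : ∀ {a b j j′} (R : MaximalRun a b) → j ∈ S R → j < x → j′ ∈ S R → ¬ y ≤ j′ + ℓ
    one-sided {b = b} {j} {j′} R j∈S j<x j′∈S y≤j′+ℓ = <-irrefl refl (begin-strict
      j′ + ℓ     <⟨ proj₁ (proj₂ (sound (uniform R) j′∈S)) ⟩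
      b          ≤⟨ proj₂ (in-every-window (uniform R) j∈S) ⟩
      j + 2 * ℓ  <⟨ +-monoˡ-< (2 * ℓ) j<x ⟩
      x + 2 * ℓ  ≤⟨ x+2ℓ≤y ⟩
      y          ≤⟨ y≤j′+ℓ ⟩
      j′ + ℓ     ∎)
      where open ≤-Reasoning

    Left Right : ∀ {a b} → MaximalRun a b → Set
    Left R = ∀ {j} → j ∈ S R → j < x
    Right R = ∀ {j} → j ∈ S R → y ≤ j + ℓ

    data Side {a b} (R : MaximalRun a b) : Set where
      inside : S R ≡ [] → Side R
      left : ∀ {j} → j ∈ S R → Left R → Side R
      right : ∀ {j} → j ∈ S R → Right R → Side R

    side-of-member : ∀ {a b j} (R : MaximalRun a b) → j ∈ S R → Side R
    side-of-member {j = j} R j∈S with j <? x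
    ... | yes j<x = left j∈S λ j′∈S →
      [ id , (λ y≤j′+ℓ → ⊥-elim (one-sided R j∈S j<x j′∈S y≤j′+ℓ)) ]′ (outside-factor R j′∈S)
    ... | no j≮x = right j∈S λ j′∈S →
      [ (λ j′<x → ⊥-elim (one-sided R j′∈S j′<x j∈S y≤j+ℓ)) , id ]′ (outside-factor R j′∈S)
      where
      y≤j+ℓ : y ≤ j + ℓ
      y≤j+ℓ = [ (λ j<x → contradiction j<x j≮x) , id ]′ (outside-factor R j∈S)

    side : ∀ {a b} (R : MaximalRun a b) → Side R
    side R with S R in S≡
    ... | [] = inside S≡
    ... | j ∷ _ = side-of-member R (subst (j ∈_) (sym S≡) (here refl))

    side-code : ∀ {a b} {R : MaximalRun a b} → Side R → ℕ
    side-code (inside _) = 0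
    side-code {R = R} (left _ _) = length (S R)
    side-code {R = R} (right _ _) = k + length (S R)

    side-code< : ∀ {a b} {R : MaximalRun a b} (s : Side R) → side-code s < 2 * k + 1
    side-code< (inside _) = m≤n+m 1 (2 * k)
    side-code< {R = R} (left _ _) = m≤n⇒m<n+1 (≤-trans (|S|≤k R) (m≤m+n k (k + 0)))
    side-code< {R = R} (right _ _) = m≤n⇒m<n+1 (+-monoʳ-≤ k (≤-trans (|S|≤k R) (m≤m+n k 0)))

    empty-run-covers-factor : ∀ {a b} (R : MaximalRun a b) → Induces x y ℓ a b → S R ≡ [] → a ≤ x × y ≤ b
    empty-run-covers-factor {a} {b} R (i , x≤i , i+ℓ<y , a≤i , i+ℓ<b) S≡[] =
      let a⊓x≡a , b⊔y≡b = inclusion-maximal R (⊓-glb (1≤a R) 1≤x) (⊔-lub (b≤n+1 R) y≤n+1)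
                            (m⊓n≤m a x) (m≤m⊔n b y) hull
      in m⊓n≡m⇒m≤n a⊓x≡a , m⊔n≡m⇒n≤m b⊔y≡b
      where
      hull : Uniform (a ⊓ x) (b ⊔ y) (S R)
      hull = Uniform-hull (i , a≤i , i+ℓ<b , x≤i , i+ℓ<y) (uniform R) (subst (Uniform x y) (sym S≡[]) factor-uniform)

    empty-runs-equal : ∀ {a b a′ b′} (R : MaximalRun a b) (R′ : MaximalRun a′ b′) →
                       Induces x y ℓ a b → Induces x y ℓ a′ b′ → S R ≡ [] → S R′ ≡ [] → (a , b) ≡ (a′ , b′)
    empty-runs-equal R R′ ind ind′ S≡[] S′≡[] =
      let a≤x , y≤b = empty-run-covers-factor R ind S≡[]
          a′≤x , y≤b′ = empty-run-covers-factor R′ ind′ S′≡[]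
      in maximal-runs-equal R R′ (subst₂ _⊆_ (sym S≡[]) (sym S′≡[]) λ ()) (subst₂ _⊆_ (sym S′≡[]) (sym S≡[]) λ ())
           (x , a≤x , <-≤-trans x+ℓ<y y≤b , a′≤x , <-≤-trans x+ℓ<y y≤b′)
      where
      x+ℓ<y : x + ℓ < y
      x+ℓ<y = <-≤-trans (m<n+o⇒m+o<n+2*o (m<m+n x 1≤ℓ)) x+2ℓ≤y

    left-runs-nested : ∀ {a b a′ b′} (R : MaximalRun a b) → Induces x y ℓ a b → (R′ : MaximalRun a′ b′) →
                       Left R′ → a ≤ a′ → S R′ ⊆ S R
    left-runs-nested R (i , x≤i , _ , _ , i+ℓ<b) R′ left′ a≤a′ j∈S′ =
      let a′≤j , _ , mj = sound (uniform R′) j∈S′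
      in complete (uniform R) (≤-trans a≤a′ a′≤j , <-trans (+-monoˡ-< ℓ (<-≤-trans (left′ j∈S′) x≤i)) i+ℓ<b , mj)

    right-runs-nested : ∀ {a b a′ b′} (R : MaximalRun a b) → Induces x y ℓ a b → (R′ : MaximalRun a′ b′) →
                        Right R′ → b′ ≤ b → S R′ ⊆ S R
    right-runs-nested R (i , _ , i+ℓ<y , a≤i , _) R′ right′ b′≤b {j} j∈S′ =
      let _ , j+ℓ<b′ , mj = sound (uniform R′) j∈S′
      in complete (uniform R)
           (≤-trans a≤i (<⇒≤ (+-cancelʳ-< ℓ i j (<-≤-trans i+ℓ<y (right′ j∈S′)))) , <-≤-trans j+ℓ<b′ b′≤b , mj)

    side-code-injective : ∀ {a b a′ b′} {R : MaximalRun a b} {R′ : MaximalRun a′ b′} →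
                          Induces x y ℓ a b → Induces x y ℓ a′ b′ → (s : Side R) (s′ : Side R′) →
                          side-code s ≡ side-code s′ → (a , b) ≡ (a′ , b′)
    side-code-injective {R = R} {R′} ind ind′ (inside S≡[]) (inside S′≡[]) _ =
      empty-runs-equal R R′ ind ind′ S≡[] S′≡[]
    side-code-injective _ _ (inside _) (left j∈S′ _) c≡c′ = contradiction c≡c′ (<⇒≢ (∈-length j∈S′))
    side-code-injective _ _ (inside _) (right j∈S′ _) c≡c′ =
      contradiction c≡c′ (<⇒≢ (≤-trans (∈-length j∈S′) (m≤n+m _ k)))
    side-code-injective _ _ (left j∈S _) (inside _) c≡c′ = contradiction (sym c≡c′) (<⇒≢ (∈-length j∈S))
    side-code-injective {a} {_} {a′} {R = R} {R′} ind ind′ (left j∈S left-R) (left j∈S′ left-R′) c≡c′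
      with ≤-total a a′
    ... | inj₁ a≤a′ = nested-runs-equal R R′ (left-runs-nested R ind R′ left-R′ a≤a′) (≤-reflexive c≡c′) j∈S′
    ... | inj₂ a′≤a =
      sym (nested-runs-equal R′ R (left-runs-nested R′ ind′ R left-R a′≤a) (≤-reflexive (sym c≡c′)) j∈S)
    side-code-injective {R = R} _ _ (left _ _) (right j∈S′ _) c≡c′ =
      contradiction c≡c′ (<⇒≢ (≤-<-trans (|S|≤k R) (m<m+n k (∈-length j∈S′))))
    side-code-injective _ _ (right j∈S _) (inside _) c≡c′ =
      contradiction (sym c≡c′) (<⇒≢ (≤-trans (∈-length j∈S) (m≤n+m _ k)))
    side-code-injective {R′ = R′} _ _ (right j∈S _) (left _ _) c≡c′ =
      contradiction (sym c≡c′) (<⇒≢ (≤-<-trans (|S|≤k R′) (m<m+n k (∈-length j∈S))))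
    side-code-injective {_} {b} {_} {b′} {R} {R′} ind ind′ (right j∈S right-R) (right j∈S′ right-R′) c≡c′
      with ≤-total b b′
    ... | inj₁ b≤b′ = sym (nested-runs-equal R′ R (right-runs-nested R′ ind′ R right-R b≤b′)
                            (≤-reflexive (sym (+-cancelˡ-≡ k _ _ c≡c′))) j∈S)
    ... | inj₂ b′≤b = nested-runs-equal R R′ (right-runs-nested R ind R′ right-R′ b′≤b)
                        (≤-reflexive (+-cancelˡ-≡ k _ _ c≡c′)) j∈S′

    InducedRun : ℕ → ℕ → Set
    InducedRun a b = MaximalUniformRun n T k ℓ a b × Induces x y ℓ a b

    code : ∀ {a b} → InducedRun a b → ℕ
    code (max , _) = side-code (side (maximalRun max))

    code< : ∀ {a b} (r : InducedRun a b) → code r < 2 * k + 1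
    code< (max , _) = side-code< (side (maximalRun max))

    code-injective : ∀ {a b a′ b′} (r : InducedRun a b) (r′ : InducedRun a′ b′) →
                     code r ≡ code r′ → (a , b) ≡ (a′ , b′)
    code-injective (max , ind) (max′ , ind′) = side-code-injective ind ind′ (side (maximalRun max)) (side (maximalRun max′))

lemma9 : {A : Set} (n : ℕ) (T : ℕ → A) (k x y ℓ : ℕ) →
    GenRun n T x y ℓ →
    (rs : List (ℕ × ℕ)) → Unique rs →
    All (λ { (a , b) → MaximalUniformRun n T k ℓ a b × Induces x y ℓ a b }) rs →
    length rs ≤ 2 * k + 1
lemma9 n T k x y ℓ ((1≤x , _ , y≤n+1) , x+2ℓ≤y , (1≤ℓ , periodic) , _) rs unique induced =
  length-≤-injective-code code code< code-injective unique induced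
  where
  open UniformRuns n T k ℓ
  open InducedBy 1≤x y≤n+1 x+2ℓ≤y 1≤ℓ periodic
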